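{- Let $IP$ be a mixed-integer linear program and $\mathtt{cert}$ a VIPR certificate for $IP$, with notation as in the context. Then $\mathtt{cert}$ is SOL-valid if and only if $\phi_{SOL}=\mathtt{true}$.
   Context: $IP$ has variables $x\in\mathbb{R}^n$, integer index set $I\subseteq[n]$, objective vector $c\in\mathbb{R}^n$, sense $\mathtt{min}$ or $\mathtt{max}$, and constraints $C_1,\dots,C_m$, where $C_i$ has coefficients $a_{i,1},\dots,a_{i,n}$, rhs $b_i$ and sign $s(C_i)\in\{ -1,0,1\}$ meaning $\le$, $=$, $\ge$ respectively. A VIPR certificate $\mathtt{cert}$ includes a relation to prove $RTP$, either $\mathtt{infeasible}$ or a pair $(lb,ub)$ with $lb\in\mathbb{R}\cup\{ -\infty\}$, $ub\in\mathbb{R}\cup\{+\infty\}$, and a finite set $SOL\subseteq\mathbb{R}^n$. A point $sol$ is feasible if $sol_j\in\mathbb{Z}$ for $j\in I$ and $sol$ satisfies $C_1,\dots,C_m$. $\mathtt{cert}$ is SOL-valid if: when $RTP=\mathtt{infeasible}$, $SOL=\emptyset$; otherwise every element of $SOL$ is feasible, and if the sense is $\mathtt{min}$ and $ub\ne\infty$ then $c\cdot sol\le ub$ for some $sol\in SOL$, while if the sense is $\mathtt{max}$ and $lb\ne-\infty$ then $c\cdot sol\ge lb$ for some $sol\in SOL$. Let $P$ be the truth value of "sense is $\mathtt{min}$", $R$ that of $RTP\ne\mathtt{infeasible}$, $PUB=R\wedge(ub\ne\infty)$, $PLB=R\wedge(lb\ne-\infty)$, $U=ub$ if $PUB$ and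 $U=0$ otherwise, $L=lb$ if $PLB$ and $L=0$ otherwise. Let $\phi_{FEAS}=\bigwedge_{sol\in SOL}\big[\bigwedge_{j\in I}(sol_j\in\mathbb{Z})\wedge\bigwedge_{i\in[m]}\big((s(C_i)\ge0\Rightarrow\sum_ja_{i,j}sol_j\ge b_i)\wedge(s(C_i)\le0\Rightarrow\sum_ja_{i,j}sol_j\le b_i)\big)\big]$. Define $\phi_{SOL}$: if $\neg R$ then $|SOL|=0$; else $\phi_{FEAS}\wedge$ (if $P$ then $(PUB\Rightarrow\bigvee_{sol\in SOL}c\cdot sol\le U)$ else $(PLB\Rightarrow\bigvee_{sol\in SOL}c\cdot sol\ge L)$). -}

module Defs where

open import Data.Bool using (Bool; true; false; not; _∧_; if_then_else_; T)
open import Data.Nat using (ℕ)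
open import Data.Integer using (ℤ; +_; -[1+_])
import Data.Integer as ℤ
open import Data.Rational using (ℚ; 0ℚ; _+_; _*_; _≤_; _≥_; _/_)
open import Data.Fin using (Fin)
open import Data.Vec.Functional using (Vector; foldr)
open import Data.List using (List; []; length)
open import Data.List.Relation.Unary.All using (All)
open import Data.List.Relation.Unary.Any using (Any)
open import Data.Maybe using (Maybe; just; nothing; is-just; fromMaybe)
open import Data.Product using (_×_; ∃-syntax)
open import Relation.Binary.PropositionalEquality using (_≡_; _≢_)

data Sense : Set where
  min max : Sense

data Sign : Set where
  le eq ge : Sign

signℤ : Sign → ℤ
signℤ le = -[1+ 0 ]
signℤ eq = + 0
signℤ ge = + 1

-- Mixed-integer linear program with rational data (VIPR uses rational numbers)
record IP : Set where
  field
    n     : ℕ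
    m     : ℕ
    Int   : Fin n → Bool
    c     : Vector ℚ n
    sense : Sense
    a     : Fin m → Vector ℚ n
    b     : Vector ℚ m
    s     : Fin m → Sign

-- Relation to prove: infeasible, or (lb, ub) with lb = nothing meaning -∞
-- and ub = nothing meaning +∞.
data RTP : Set where
  infeasible : RTP
  bounds     : (lb : Maybe ℚ) (ub : Maybe ℚ) → RTP

-- The parts of a VIPR certificate relevant here (the derivation part is irrelevant)
record Cert (n : ℕ) : Set where
  field
    rtp : RTP
    SOL : List (Vector ℚ n)

_·_ : ∀ {n} → Vector ℚ n → Vector ℚ n → ℚ
x · y = foldr _+_ 0ℚ (λ j → x j * y j)

IsInteger : ℚ → Set
IsInteger q = ∃[ z ] q ≡ z / 1

SatSign : Sign → ℚ → ℚ → Set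
SatSign le lhs rhs = lhs ≤ rhs
SatSign eq lhs rhs = lhs ≡ rhs
SatSign ge lhs rhs = lhs ≥ rhs

module _ (ip : IP) where
  open IP ip

  Feasible : Vector ℚ n → Set
  Feasible sol =
    (∀ j → T (Int j) → IsInteger (sol j)) ×
    (∀ i → SatSign (s i) (a i · sol) (b i))

  SOLValid : Cert n → Set
  SOLValid cert with Cert.rtp cert
  ... | infeasible = Cert.SOL cert ≡ []
  ... | bounds lb ub =
        All Feasible (Cert.SOL cert) ×
        ((sense ≡ min → ub ≢ nothing → Any (λ sol → ∃[ u ] (ub ≡ just u × c · sol ≤ u)) (Cert.SOL cert)) ×
         (sense ≡ max → lb ≢ nothing → Any (λ sol → ∃[ l ] (lb ≡ just l × c · sol ≥ l)) (Cert.SOL cert)))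

  P : Bool
  P with sense
  ... | min = true
  ... | max = false

  R : RTP → Bool
  R infeasible = false
  R (bounds _ _) = true

  ubOf : RTP → Maybe ℚ
  ubOf infeasible = nothing
  ubOf (bounds _ ub) = ub

  lbOf : RTP → Maybe ℚ
  lbOf infeasible = nothing
  lbOf (bounds lb _) = lb

  PUB : RTP → Bool
  PUB r = R r ∧ is-just (ubOf r)

  PLB : RTP → Bool
  PLB r = R r ∧ is-just (lbOf r)

  U : RTP → ℚ
  U r = if PUB r then fromMaybe 0ℚ (ubOf r) else 0ℚ

  L : RTP → ℚ
  L r = if PLB r then fromMaybe 0ℚ (lbOf r) else 0ℚ

  φFEAS : List (Vector ℚ n) → Set
  φFEAS SOL = All (λ sol →
      (∀ j → T (Int j) → IsInteger (sol j)) ×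
      (∀ i → (signℤ (s i) ℤ.≥ + 0 → a i · sol ≥ b i) ×
             (signℤ (s i) ℤ.≤ + 0 → a i · sol ≤ b i))) SOL

  φSOL : Cert n → Set
  φSOL cert =
    if not (R r) then length SOL ≡ 0
    else (φFEAS SOL ×
          (if P then (T (PUB r) → Any (λ sol → c · sol ≤ U r) SOL)
                 else (T (PLB r) → Any (λ sol → c · sol ≥ L r) SOL)))
    where
      r = Cert.rtp cert
      SOL = Cert.SOL cert

{-# OPTIONS --safe #-}
module Submission where

-- The two real
-- translations are that s(C) ∈ {-1,0,1} selects ≤, = or ≥ through two sign
-- tests (= being the conjunction of ≤ and ≥), and that a finite bound, encoded
-- by Maybe, is attained by some solution exactly when the guarded disjunction
-- with U (resp. L) holds; the clause of the other sense is vacuous.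

open import Defs
open import Function.Bundles using (_⇔_; mk⇔; Equivalence)
open import Function.Construct.Composition using (_⇔-∘_)
open import Function.Properties.Inverse using (↔⇒⇔)
open import Data.Bool using (if_then_else_; T)
open import Data.Unit using (tt)
open import Data.Maybe using (Maybe; just; nothing; is-just; fromMaybe)
open import Data.Product using (_×_; _,_; ∃-syntax; map₂)
open import Data.Product.Algebra using (×-comm)
open import Data.Product.Function.NonDependent.Propositional using (_×-⇔_)
open import Data.List using (List; []; _∷_; length)
open import Data.List.Relation.Unary.All using (All)
import Data.List.Relation.Unary.All as All
open import Data.List.Relation.Unary.Any using (Any)
import Data.List.Relation.Unary.Any as Any
open import Data.Nat using (z≤n)
open import Data.Integer using (+_; +≤+; -≤+)
import Data.Integer as ℤ
open import Data.Rational using (ℚ; 0ℚ; _≤_; _≥_)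
open import Data.Rational.Properties using (≤-antisym; ≤-refl)
open import Data.Vec.Functional using (Vector)
open import Relation.Nullary using (¬_; contradiction)
open import Relation.Binary.PropositionalEquality using (_≡_; _≢_; refl; cong)

open Equivalence using (to; from)

≡[]⇔length≡0 : ∀ {A : Set} (xs : List A) → (xs ≡ []) ⇔ (length xs ≡ 0)
≡[]⇔length≡0 []      = mk⇔ (cong length) (λ _ → refl)
≡[]⇔length≡0 (_ ∷ _) = mk⇔ (λ ()) (λ ())

SignedSat : Sign → ℚ → ℚ → Set
SignedSat s lhs rhs = (signℤ s ℤ.≥ + 0 → lhs ≥ rhs) × (signℤ s ℤ.≤ + 0 → lhs ≤ rhs)

satSign⇔signedSat : ∀ s {lhs rhs} → SatSign s lhs rhs ⇔ SignedSat s lhs rhs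
satSign⇔signedSat le = mk⇔ (λ p → (λ ()) , (λ _ → p)) (λ (_ , p) → p -≤+)
satSign⇔signedSat eq = mk⇔ (λ { refl → (λ _ → ≤-refl) , (λ _ → ≤-refl) })
                           (λ (p , q) → ≤-antisym (q (+≤+ z≤n)) (p (+≤+ z≤n)))
satSign⇔signedSat ge = mk⇔ (λ p → (λ _ → p) , (λ { (+≤+ ()) })) (λ (p , _) → p (+≤+ z≤n))

All-⇔ : ∀ {A : Set} {P Q : A → Set} {xs : List A} → (∀ {x} → P x ⇔ Q x) → All P xs ⇔ All Q xs
All-⇔ P⇔Q = mk⇔ (All.map (to P⇔Q)) (All.map (from P⇔Q))

allFeasible⇔φFEAS : (ip : IP) (sols : List (Vector ℚ (IP.n ip))) → All (Feasible ip) sols ⇔ φFEAS ip sols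
allFeasible⇔φFEAS ip sols = All-⇔ (mk⇔ (map₂ λ sat i → to   (satSign⇔signedSat (s i)) (sat i))
                                       (map₂ λ sat i → from (satSign⇔signedSat (s i)) (sat i)))
  where open IP ip

onlyClauseˡ : ∀ {A B X Y : Set} → A → ¬ B → ((A → X) × (B → Y)) ⇔ X
onlyClauseˡ a ¬b = mk⇔ (λ (x , _) → x a) (λ x → (λ _ → x) , (λ b → contradiction b ¬b))

-- The right-hand side is the shape U and L take once R holds.
attainedBound⇔ : ∀ {A : Set} (Q : A → ℚ → Set) (xs : List A) (bound : Maybe ℚ) →
  (bound ≢ nothing → Any (λ x → ∃[ v ] (bound ≡ just v × Q x v)) xs) ⇔
  (T (is-just bound) → Any (λ x → Q x (if is-just bound then fromMaybe 0ℚ bound else 0ℚ)) xs)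
attainedBound⇔ Q xs (just v) = mk⇔ (λ attained _ → Any.map (λ { (_ , refl , q) → q }) (attained λ ()))
                                   (λ attained _ → Any.map (λ q → v , refl , q) (attained tt))
attainedBound⇔ Q xs nothing  = mk⇔ (λ _ ()) (λ _ nothing≢nothing → contradiction refl nothing≢nothing)

lemma2 : (ip : IP) (cert : Cert (IP.n ip)) → SOLValid ip cert ⇔ φSOL ip cert
lemma2 ip record { rtp = infeasible ; SOL = sols } = ≡[]⇔length≡0 sols
lemma2 ip@record { sense = min } record { rtp = bounds lb ub ; SOL = sols } =
  allFeasible⇔φFEAS ip sols
  ×-⇔ (attainedBound⇔ (λ sol u → IP.c ip · sol ≤ u) sols ub ⇔-∘ onlyClauseˡ refl (λ ()))
lemma2 ip@record { sense = max } record { rtp = bounds lb ub ; SOL = sols } =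
  allFeasible⇔φFEAS ip sols
  ×-⇔ (attainedBound⇔ (λ sol l → IP.c ip · sol ≥ l) sols lb ⇔-∘ (onlyClauseˡ refl (λ ()) ⇔-∘ ↔⇒⇔ (×-comm _ _)))
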